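{- Fix $n \ge 1$ and $k \ge 2$, and let $\pi \in S_n(132, 213, 23\ldots k\,1)$. If $\pi^{ -1}(n) \ge k-1$, then $\pi = 12\ldots n$ (the identity permutation).
   Context: Permutations of $[n]$ are written in one-line notation, and $S_n$ denotes the set of them; $\pi^{ -1}(n)$ is the position of the entry $n$. A permutation $\pi\in S_n$ contains $\sigma\in S_m$ if there are indices $i_1<\dots<i_m$ such that for all $a,b$, $\pi(i_a)<\pi(i_b)$ iff $\sigma(a)<\sigma(b)$; otherwise $\pi$ avoids $\sigma$. For a set $R$ of permutations, $S_n(R)$ is the set of $\pi\in S_n$ avoiding every element of $R$. The permutation $23\ldots k\,1\in S_k$ is $2,3,\dots,k$ followed by $1$. -}

module Defs where

open import Data.Nat using (ℕ; zero; suc)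
open import Data.Fin using (Fin; zero; suc; _<_; fromℕ; inject₁)
open import Data.Fin.Permutation using (Permutation′; _⟨$⟩ʳ_)
open import Data.Product using (Σ; _×_)
open import Relation.Nullary using (¬_)
open import Function.Bundles using (_⇔_)

-- Convention: [n] is represented by Fin n with values shifted down by one
-- (value j ∈ Fin n stands for j+1); positions likewise (position i ∈ Fin n
-- stands for i+1).

Contains : {n m : ℕ} → Permutation′ n → (Fin m → Fin m) → Set
Contains {n} {m} π σ =
  Σ (Fin m → Fin n) λ e →
    ((a b : Fin m) → a < b → e a < e b) ×
    ((a b : Fin m) → ((π ⟨$⟩ʳ e a) < (π ⟨$⟩ʳ e b)) ⇔ (σ a < σ b))

Avoids : {n m : ℕ} → Permutation′ n → (Fin m → Fin m) → Set
Avoids π σ = ¬ Contains π σ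

p132 : Fin 3 → Fin 3
p132 zero = zero
p132 (suc zero) = suc (suc zero)
p132 (suc (suc zero)) = suc zero

p213 : Fin 3 → Fin 3
p213 zero = suc zero
p213 (suc zero) = zero
p213 (suc (suc zero)) = suc (suc zero)

-- The pattern 23…k1 ∈ S_k, for k = suc j: position i < j holds value i+2
-- (0-indexed: i+1), and the last position j holds value 1 (0-indexed: 0).
cycPat : (j : ℕ) → Fin (suc j) → Fin (suc j)
cycPat zero zero = zero
cycPat (suc j) zero = suc zero
cycPat (suc j) (suc i) with cycPat j i
... | zero = zero
... | suc r = suc (suc r)

module Submission where

-- By 213-avoidance the entries up to the maximum n increase: a descent before n, followed by n, is a 213.
-- If n were not last, 132-avoidance would put the last entry below every entry up to n, and then
-- the first j entries, n and the last entry would form 23…k1, which fits because n sits at a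
-- position ≥ k − 1. So n is last, π is increasing, and an increasing permutation is the identity.

open import Defs
open import Data.Nat as ℕ using (ℕ; zero; suc)
import Data.Nat.Properties as ℕ
open import Data.Fin using (Fin; zero; suc; toℕ; fromℕ; inject₁; inject≤; _<_; _≤_)
open import Data.Fin.Properties
  using (toℕ<n; toℕ≤n; toℕ-inject₁; toℕ-inject≤; ≤fromℕ; ≤-refl; ≤-antisym; <-cmp; <-irrefl;
         <-asym; <⇒≢; ≤∧≢⇒<; ≤̄⇒inject₁<; _≟_)
open import Data.Fin.Permutation using (Permutation′; _⟨$⟩ʳ_; _⟨$⟩ˡ_; inverseˡ; inverseʳ)
open import Data.Fin.Relation.Unary.Top using (view; ‵fromℕ; ‵inj₁; view-fromℕ; view-inject₁)
open import Data.Vec.Functional using (_∷_; [])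
open import Data.Empty using (⊥-elim)
open import Data.Product using (_,_)
open import Function.Base using (_∘_)
open import Function.Bundles using (mk⇔)
open import Relation.Binary.Core using (_Preserves_⟶_)
open import Relation.Binary.Definitions using (tri<; tri≈; tri>)
open import Relation.Binary.PropositionalEquality
open import Relation.Nullary using (yes; no; contradiction)

private
  variable
    m n : ℕ

StrictlyIncreasing : (Fin m → Fin n) → Set
StrictlyIncreasing h = h Preserves _<_ ⟶ _<_

inject₁<suc : (i : Fin n) → inject₁ i < suc i
inject₁<suc i = ≤̄⇒inject₁< ≤-refl

inject₁-strictlyIncreasing : StrictlyIncreasing (inject₁ {n})
inject₁-strictlyIncreasing {x = a} {b} = subst₂ ℕ._<_ (sym (toℕ-inject₁ a)) (sym (toℕ-inject₁ b))

module _ {h : Fin m → Fin n} (h↑ : StrictlyIncreasing h) where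

  strictlyIncreasing⇒reflects : ∀ {a b} → h a < h b → a < b
  strictlyIncreasing⇒reflects {a} {b} ha<hb with <-cmp a b
  ... | tri< a<b _ _ = a<b
  ... | tri≈ _ refl _ = contradiction ha<hb (<-irrefl refl)
  ... | tri> _ _ b<a = contradiction (h↑ b<a) (<-asym ha<hb)

  strictlyIncreasing⇒monotone : ∀ {a b} → a ≤ b → h a ≤ h b
  strictlyIncreasing⇒monotone {a} {b} a≤b with a ≟ b
  ... | yes refl = ≤-refl
  ... | no a≢b = ℕ.<⇒≤ (h↑ (≤∧≢⇒< a≤b a≢b))

strictlyIncreasing⇒inflationary : {h : Fin m → Fin n} → StrictlyIncreasing h → ∀ i → i ≤ h i
strictlyIncreasing⇒inflationary h↑ zero = ℕ.z≤n
strictlyIncreasing⇒inflationary h↑ (suc i) =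
  ℕ.≤-<-trans (strictlyIncreasing⇒inflationary (h↑ ∘ inject₁-strictlyIncreasing) i)
              (h↑ (inject₁<suc i))

adjacent⇒strictlyIncreasing : (h : Fin (suc m) → Fin n) →
  (∀ i → h (inject₁ i) < h (suc i)) → StrictlyIncreasing h
adjacent⇒strictlyIncreasing {suc m} h step {zero} {suc zero} _ = step zero
adjacent⇒strictlyIncreasing {suc m} h step {zero} {suc (suc b)} _ =
  ℕ.<-trans (step zero) (adjacent⇒strictlyIncreasing (h ∘ suc) (step ∘ suc) {zero} {suc b} ℕ.z<s)
adjacent⇒strictlyIncreasing {suc m} h step {suc a} {suc b} (ℕ.s<s a<b) =
  adjacent⇒strictlyIncreasing (h ∘ suc) (step ∘ suc) a<b

_∷ʳ_ : {A : Set} → (Fin m → A) → A → Fin (suc m) → A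
(xs ∷ʳ x) i with view i
... | ‵fromℕ = x
... | ‵inj₁ {i = j} _ = xs j

∷ʳ-fromℕ : {A : Set} (xs : Fin m → A) (x : A) → (xs ∷ʳ x) (fromℕ m) ≡ x
∷ʳ-fromℕ {m} xs x rewrite view-fromℕ m = refl

∷ʳ-inject₁ : {A : Set} (xs : Fin m → A) (x : A) (i : Fin m) → (xs ∷ʳ x) (inject₁ i) ≡ xs i
∷ʳ-inject₁ xs x i rewrite view-inject₁ i = refl

∷ʳ-strictlyIncreasing : {xs : Fin m → Fin n} {x : Fin n} →
  StrictlyIncreasing xs → (∀ i → xs i < x) → StrictlyIncreasing (xs ∷ʳ x)
∷ʳ-strictlyIncreasing xs↑ xs<x {a} {b} a<b with view a | view b
... | ‵fromℕ | _ = contradiction (≤fromℕ b) (ℕ.<⇒≱ a<b)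
... | ‵inj₁ {i = i} _ | ‵fromℕ = xs<x i
... | ‵inj₁ {i = i} _ | ‵inj₁ {i = j} _ = xs↑ (subst₂ ℕ._<_ (toℕ-inject₁ i) (toℕ-inject₁ j) a<b)

strictlyIncreasing-permutation⇒id : (π : Permutation′ n) → StrictlyIncreasing (π ⟨$⟩ʳ_) →
  ∀ i → π ⟨$⟩ʳ i ≡ i
strictlyIncreasing-permutation⇒id π π↑ i =
  ≤-antisym (subst (π ⟨$⟩ʳ i ≤_) (inverseˡ π) (strictlyIncreasing⇒inflationary π⁻¹↑ (π ⟨$⟩ʳ i)))
            (strictlyIncreasing⇒inflationary π↑ i)
  where
  π⁻¹↑ : StrictlyIncreasing (π ⟨$⟩ˡ_)
  π⁻¹↑ a<b = strictlyIncreasing⇒reflects π↑ (subst₂ _<_ (sym (inverseʳ π)) (sym (inverseʳ π)) a<b)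

occurrence⇒contains : (π : Permutation′ n) (σ : Fin m → Fin m) (e w : Fin m → Fin n) →
  StrictlyIncreasing e → StrictlyIncreasing w → (∀ a → π ⟨$⟩ʳ e a ≡ w (σ a)) → Contains π σ
occurrence⇒contains π σ e w e↑ w↑ πe≡wσ = e , (λ _ _ → e↑) , λ a b → mk⇔
  (λ πea<πeb → strictlyIncreasing⇒reflects w↑ (subst₂ _<_ (πe≡wσ a) (πe≡wσ b) πea<πeb))
  (λ σa<σb → subst₂ _<_ (sym (πe≡wσ a)) (sym (πe≡wσ b)) (w↑ σa<σb))

cycPat-inverse : ∀ j a → (fromℕ j ∷ inject₁) (cycPat j a) ≡ a
cycPat-inverse zero zero = refl
cycPat-inverse (suc j) zero = refl
cycPat-inverse (suc j) (suc i) with cycPat j i | cycPat-inverse j i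
... | zero | fromℕj≡i = cong suc fromℕj≡i
... | suc r | inject₁r≡i = cong suc inject₁r≡i

module _ (π : Permutation′ (suc n)) where

  maxPosition : Fin (suc n)
  maxPosition = π ⟨$⟩ˡ fromℕ n

  private
    P = maxPosition
    Q = fromℕ n

  injective : ∀ {x y} → π ⟨$⟩ʳ x ≡ π ⟨$⟩ʳ y → x ≡ y
  injective {x} {y} πx≡πy = begin
    x                          ≡⟨ inverseˡ π ⟨
    π ⟨$⟩ˡ (π ⟨$⟩ʳ x)          ≡⟨ cong (π ⟨$⟩ˡ_) πx≡πy ⟩
    π ⟨$⟩ˡ (π ⟨$⟩ʳ y)          ≡⟨ inverseˡ π ⟩
    y                          ∎
    where open ≡-Reasoning

  <max : ∀ {x} → x ≢ P → π ⟨$⟩ʳ x < π ⟨$⟩ʳ P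
  <max {x} x≢P = subst (π ⟨$⟩ʳ x <_) (sym (inverseʳ π))
    (≤∧≢⇒< (≤fromℕ _) (λ πx≡max → x≢P (injective (trans πx≡max (sym (inverseʳ π))))))

  avoid213⇒increasingUpToMax : Avoids π p213 → ∀ {x y} → x < y → y ≤ P → π ⟨$⟩ʳ x < π ⟨$⟩ʳ y
  avoid213⇒increasingUpToMax avoid213 {x} {y} x<y y≤P with y ≟ P
  ... | yes refl = <max (<⇒≢ x<y)
  ... | no y≢P with <-cmp (π ⟨$⟩ʳ x) (π ⟨$⟩ʳ y)
  ...   | tri< πx<πy _ _ = πx<πy
  ...   | tri≈ _ πx≡πy _ = contradiction (injective πx≡πy) (<⇒≢ x<y)
  ...   | tri> _ _ πy<πx = ⊥-elim (avoid213 (occurrence⇒contains π p213 e w e↑ w↑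
            λ { zero → refl ; (suc zero) → refl ; (suc (suc zero)) → refl }))
    where
    e w : Fin 3 → Fin (suc n)
    e = x ∷ y ∷ P ∷ []
    w = (π ⟨$⟩ʳ_) ∘ (y ∷ x ∷ P ∷ [])
    e↑ : StrictlyIncreasing e
    e↑ = adjacent⇒strictlyIncreasing e λ { zero → x<y ; (suc zero) → ≤∧≢⇒< y≤P y≢P }
    w↑ : StrictlyIncreasing w
    w↑ = adjacent⇒strictlyIncreasing w λ { zero → πy<πx ; (suc zero) → <max (<⇒≢ (ℕ.<-≤-trans x<y y≤P)) }

  avoid132⇒lastBelowUpToMax : Avoids π p132 → P < Q → ∀ {x} → x ≤ P → π ⟨$⟩ʳ Q < π ⟨$⟩ʳ x
  avoid132⇒lastBelowUpToMax avoid132 P<Q {x} x≤P with x ≟ P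
  ... | yes refl = <max (<⇒≢ P<Q ∘ sym)
  ... | no x≢P with <-cmp (π ⟨$⟩ʳ x) (π ⟨$⟩ʳ Q)
  ...   | tri> _ _ πQ<πx = πQ<πx
  ...   | tri≈ _ πx≡πQ _ = contradiction (injective πx≡πQ) (<⇒≢ (ℕ.≤-<-trans x≤P P<Q))
  ...   | tri< πx<πQ _ _ = ⊥-elim (avoid132 (occurrence⇒contains π p132 e w e↑ w↑
            λ { zero → refl ; (suc zero) → refl ; (suc (suc zero)) → refl }))
    where
    e w : Fin 3 → Fin (suc n)
    e = x ∷ P ∷ Q ∷ []
    w = (π ⟨$⟩ʳ_) ∘ (x ∷ Q ∷ P ∷ [])
    e↑ : StrictlyIncreasing e
    e↑ = adjacent⇒strictlyIncreasing e λ { zero → ≤∧≢⇒< x≤P x≢P ; (suc zero) → P<Q }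
    w↑ : StrictlyIncreasing w
    w↑ = adjacent⇒strictlyIncreasing w λ { zero → πx<πQ ; (suc zero) → <max (<⇒≢ P<Q ∘ sym) }

  contains-cycPat : Avoids π p132 → Avoids π p213 → P < Q →
    ∀ j → j ℕ.≤ toℕ P → Contains π (cycPat (suc j))
  contains-cycPat avoid132 avoid213 P<Q j j≤P =
    occurrence⇒contains π (cycPat (suc j)) e w e↑ w↑ πe≡wσ
    where
    prefix : Fin j → Fin (suc n)
    prefix i = inject≤ i (ℕ.≤-trans j≤P (toℕ≤n P))

    prefix↑ : StrictlyIncreasing prefix
    prefix↑ {a} {b} = subst₂ ℕ._<_ (sym (toℕ-inject≤ a _)) (sym (toℕ-inject≤ b _))

    prefix<P : ∀ i → prefix i < P
    prefix<P i = subst (ℕ._< toℕ P) (sym (toℕ-inject≤ i _)) (ℕ.<-≤-trans (toℕ<n i) j≤P)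

    run : Fin (suc j) → Fin (suc n)
    run = prefix ∷ʳ P

    run↑ : StrictlyIncreasing run
    run↑ = ∷ʳ-strictlyIncreasing prefix↑ prefix<P

    run≤P : ∀ c → run c ≤ P
    run≤P c = subst (run c ≤_) (∷ʳ-fromℕ prefix P) (strictlyIncreasing⇒monotone run↑ (≤fromℕ c))

    e w : Fin (suc (suc j)) → Fin (suc n)
    e = run ∷ʳ Q
    w = (π ⟨$⟩ʳ_) ∘ (Q ∷ run)

    e↑ : StrictlyIncreasing e
    e↑ = ∷ʳ-strictlyIncreasing run↑ (λ c → ℕ.≤-<-trans (run≤P c) P<Q)

    w↑ : StrictlyIncreasing w
    w↑ = adjacent⇒strictlyIncreasing w λ
      { zero    → avoid132⇒lastBelowUpToMax avoid132 P<Q (run≤P zero)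
      ; (suc c) → avoid213⇒increasingUpToMax avoid213 (run↑ (inject₁<suc c)) (run≤P (suc c))
      }

    e∘cycPat⁻¹≡Q∷run : ∀ c → e ((fromℕ (suc j) ∷ inject₁) c) ≡ (Q ∷ run) c
    e∘cycPat⁻¹≡Q∷run zero    = ∷ʳ-fromℕ run Q
    e∘cycPat⁻¹≡Q∷run (suc c) = ∷ʳ-inject₁ run Q c

    πe≡wσ : ∀ a → π ⟨$⟩ʳ e a ≡ w (cycPat (suc j) a)
    πe≡wσ a = cong (π ⟨$⟩ʳ_) (begin
      e a                                                 ≡⟨ cong e (cycPat-inverse (suc j) a) ⟨
      e ((fromℕ (suc j) ∷ inject₁) (cycPat (suc j) a))    ≡⟨ e∘cycPat⁻¹≡Q∷run (cycPat (suc j) a) ⟩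
      (Q ∷ run) (cycPat (suc j) a)                        ∎)
      where open ≡-Reasoning

  maxPosition≡last : Avoids π p132 → Avoids π p213 → ∀ j → Avoids π (cycPat (suc j)) →
    j ℕ.≤ toℕ P → P ≡ Q
  maxPosition≡last avoid132 avoid213 j avoidCyc j≤P with P ≟ Q
  ... | yes P≡Q = P≡Q
  ... | no P≢Q = ⊥-elim (avoidCyc (contains-cycPat avoid132 avoid213 (≤∧≢⇒< (≤fromℕ P) P≢Q) j j≤P))

lemma5p2 : (n' j : ℕ) (π : Permutation′ (suc n')) →
    Avoids π p132 → Avoids π p213 → Avoids π (cycPat (suc j)) →
    j ℕ.≤ toℕ (π ⟨$⟩ˡ fromℕ n') →
    (i : Fin (suc n')) → π ⟨$⟩ʳ i ≡ i
lemma5p2 n' j π avoid132 avoid213 avoidCyc j≤P = strictlyIncreasing-permutation⇒id π π↑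
  where
  π↑ : StrictlyIncreasing (π ⟨$⟩ʳ_)
  π↑ {y = y} x<y = avoid213⇒increasingUpToMax π avoid213 x<y
    (subst (y ≤_) (sym (maxPosition≡last π avoid132 avoid213 j avoidCyc j≤P)) (≤fromℕ y))
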